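{- The radio number of $K_2\square K_3\square K_3$ is $20$.
   Context: $K_n$ is the complete graph on $n$ vertices and $\square$ the Cartesian product of graphs. For a simple connected graph $G$, a map $f:V(G)\to\mathbb{Z}_+$ is a radio labeling if $|f(u)-f(v)|\geq \mathrm{diam}(G)+1-d(u,v)$ for all distinct $u,v\in V(G)$; its span is the largest value of $f$, and the radio number $\mathrm{rn}(G)$ is the minimum span over all radio labelings of $G$. -}

module Defs where

open import Data.Nat using (ℕ; zero; suc; _+_; _≤_; _<_; ∣_-_∣)
open import Data.Fin using (Fin)
open import Data.Product using (_×_; Σ; ∃; ∃-syntax; _,_)
open import Data.Sum using (_⊎_)
open import Relation.Nullary using (¬_)
open import Relation.Binary.PropositionalEquality using (_≡_; _≢_)

record Graph : Set₁ where
  field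
    V   : Set
    Adj : V → V → Set

open Graph public

K : ℕ → Graph
K n = record { V = Fin n ; Adj = λ x y → x ≢ y }

_□_ : Graph → Graph → Graph
G □ H = record
  { V   = V G × V H
  ; Adj = λ { (g , h) (g' , h') →
              (Adj G g g' × h ≡ h') ⊎ (g ≡ g' × Adj H h h') } }
infixr 6 _□_

data Walk (G : Graph) : V G → V G → ℕ → Set where
  here : ∀ {u} → Walk G u u zero
  step : ∀ {u w v k} → Adj G u w → Walk G w v k → Walk G u v (suc k)

Dist : (G : Graph) → V G → V G → ℕ → Set
Dist G u v k = Walk G u v k × (∀ j → j < k → ¬ Walk G u v j)

-- diam(G) = D : all distances are at most D and some distance equals D.
-- (This also entails connectedness.)
IsDiam : (G : Graph) → ℕ → Set
IsDiam G D = (∀ u v → ∃[ k ] (k ≤ D × Walk G u v k))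
           × (∃[ u ] ∃[ v ] Dist G u v D)

IsRadioLabeling : (G : Graph) → (V G → ℕ) → Set
IsRadioLabeling G f =
    (∀ v → 1 ≤ f v)
  × (∀ D → IsDiam G D → ∀ u v → u ≢ v → ∀ k → Dist G u v k →
       D + 1 ≤ ∣ f u - f v ∣ + k)

RadioNumber : Graph → ℕ → Set
RadioNumber G r =
    (∃[ f ] (IsRadioLabeling G f × (∀ v → f v ≤ r)))
  × (∀ f → IsRadioLabeling G f → ∃[ v ] (r ≤ f v))

-- In K₂ □ K₃ □ K₃ the distance is the Hamming distance on Fin 2 × Fin 3 × Fin 3, so the
-- diameter is 3 and a radio labeling must satisfy |f u − f v| ≥ 4 − d(u, v). Labels are then
-- distinct, vertices with consecutive labels differ in every coordinate, and vertices whose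
-- labels differ by 2 differ in at least two coordinates. Along a run of consecutive labels the
-- K₂-coordinate therefore alternates and each K₃-coordinate cycles with period 3, so a run of
-- seven consecutive labels would return to its first vertex. Hence each of the blocks 1..7 and
-- 8..14 misses a label, and 18 distinct labels need span at least 20, which is attained.
module Submission where

open import Defs
open import Data.Nat using (ℕ; zero; suc; _+_; _≤_; _<_; ∣_-_∣; z≤n; s≤s; s≤s⁻¹; _≤?_; _<?_)
open import Data.Nat.Properties
  using (module ≤-Reasoning; ≤-trans; ≤-reflexive; ≤-antisym; ≮⇒≥; <⇒≱; ≤-<-trans; +-suc; +-comm; +-mono-≤; +-monoˡ-≤; +-monoʳ-≤;
         +-cancelˡ-≤; +-cancelʳ-≤; +-cancelˡ-<; m≢1+n+m; m≤m+n; m≤n+m; +-mono-<-≤; +-monoˡ-<; 1+n≰n; ≰⇒>; ∣m-m+n∣≡n; ∣n-n∣≡0)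
open import Data.Fin using (Fin; toℕ; fromℕ<; punchOut; #_) renaming (_≟_ to _≟ᶠ_)
open import Data.Fin.Patterns using (0F; 1F; 2F)
open import Data.Fin.Properties using (any?; all?; punchOut-injective; injective⇒≤; *↔×; toℕ-fromℕ<; toℕ<n)
open import Data.Product using (_×_; ∃; ∃-syntax; ∃₂; _,_; proj₁; proj₂)
open import Data.Product.Properties using (≡-dec)
open import Data.Product.Function.NonDependent.Propositional using (_×-↔_)
open import Data.Sum using (inj₁; inj₂)
open import Data.Empty using (⊥; ⊥-elim)
open import Function using (_∘_; Injective; _↣_; Injection)
open import Function.Properties.Inverse using (↔-refl; ↔-trans; ↔⇒↣)
open import Relation.Nullary using (¬_; Dec; yes; no; ¬?)
open import Relation.Nullary.Decidable using (map′; toWitness; _×-dec_; _→-dec_; decidable-stable)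
open import Relation.Unary using (Decidable)
open import Relation.Binary.PropositionalEquality using (_≡_; _≢_; refl; sym; trans; cong; cong₂; subst)

module _ {G : Graph} where

  _++ʷ_ : ∀ {u w v k l} → Walk G u w k → Walk G w v l → Walk G u v (k + l)
  here     ++ʷ q = q
  step e p ++ʷ q = step e (p ++ʷ q)

  walk₀⇒≡ : ∀ {u v} → Walk G u v 0 → u ≡ v
  walk₀⇒≡ here = refl

  Dist-unique : ∀ {u v k l} → Dist G u v k → Dist G u v l → k ≡ l
  Dist-unique (p , p-minimal) (q , q-minimal) =
    ≤-antisym (≮⇒≥ λ l<k → p-minimal _ l<k q) (≮⇒≥ λ k<l → q-minimal _ k<l p)

  IsDiam-unique : ∀ {D D′} → IsDiam G D → IsDiam G D′ → D ≡ D′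
  IsDiam-unique (walks , _ , _ , d) (walks′ , _ , _ , d′) =
    ≤-antisym (distance≤diam walks′ d) (distance≤diam walks d′)
    where
    distance≤diam : ∀ {D k u v} → (∀ u v → ∃[ j ] (j ≤ D × Walk G u v j)) → Dist G u v k → k ≤ D
    distance≤diam {u = u} {v} walks (_ , k-minimal) with walks u v
    ... | j , j≤D , p = ≤-trans (≮⇒≥ λ j<k → k-minimal j j<k p) j≤D

  isRadioLabeling : ∀ {D} (d : V G → V G → ℕ) {f : V G → ℕ} →
                    IsDiam G D → (∀ u v → Dist G u v (d u v)) →
                    (∀ v → 1 ≤ f v) → (∀ u v → u ≢ v → D + 1 ≤ ∣ f u - f v ∣ + d u v) →
                    IsRadioLabeling G f
  isRadioLabeling d {f} diam d-dist f≥1 far = f≥1 , radio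
    where
    radio : ∀ D′ → IsDiam G D′ → ∀ u v → u ≢ v → ∀ k → Dist G u v k → D′ + 1 ≤ ∣ f u - f v ∣ + k
    radio D′ diam′ u v u≢v k dist-k
      rewrite sym (IsDiam-unique diam diam′) | Dist-unique dist-k (d-dist u v) = far u v u≢v

module _ {A B : Graph} where

  mapˡ : ∀ {g g′ h k} → Walk A g g′ k → Walk (A □ B) (g , h) (g′ , h) k
  mapˡ here       = here
  mapˡ (step e p) = step (inj₁ (e , refl)) (mapˡ p)

  mapʳ : ∀ {g h h′ k} → Walk B h h′ k → Walk (A □ B) (g , h) (g , h′) k
  mapʳ here       = here
  mapʳ (step e p) = step (inj₂ (refl , e)) (mapʳ p)

  unzip : ∀ {u v k} → Walk (A □ B) u v k →
          ∃₂ λ i j → i + j ≡ k × Walk A (proj₁ u) (proj₁ v) i × Walk B (proj₂ u) (proj₂ v) j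
  unzip here = 0 , 0 , refl , here , here
  unzip (step (inj₁ (e , refl)) p) with unzip p
  ... | i , j , refl , p₁ , p₂ = suc i , j , refl , step e p₁ , p₂
  unzip (step (inj₂ (refl , e)) p) with unzip p
  ... | i , j , refl , p₁ , p₂ = i , suc j , +-suc i j , p₁ , step e p₂

  Dist-□ : ∀ {g g′ h h′ a b} → Dist A g g′ a → Dist B h h′ b → Dist (A □ B) (g , h) (g′ , h′) (a + b)
  Dist-□ {a = a} {b} (p , p-minimal) (q , q-minimal) = mapˡ p ++ʷ mapʳ q , minimal
    where
    minimal : ∀ k → k < a + b → ¬ Walk (A □ B) _ _ k
    minimal k k<a+b r with unzip r
    ... | i , j , refl , r₁ , r₂ with i <? a
    ... | yes i<a = p-minimal i i<a r₁
    ... | no  i≮a = q-minimal j (+-cancelˡ-< a j b (≤-<-trans (+-monoˡ-≤ j (≮⇒≥ i≮a)) k<a+b)) r₂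

distK : ∀ {n} → Fin n → Fin n → ℕ
distK x y with x ≟ᶠ y
... | yes _ = 0
... | no  _ = 1

Dist-K : ∀ {n} (x y : Fin n) → Dist (K n) x y (distK x y)
Dist-K x y with x ≟ᶠ y
... | yes refl = here , λ _ ()
... | no  x≢y  = step x≢y here , λ { zero _ p → x≢y (walk₀⇒≡ p) ; (suc _) (s≤s ()) _ }

distK≤1 : ∀ {n} (x y : Fin n) → distK x y ≤ 1
distK≤1 x y with x ≟ᶠ y
... | yes _ = z≤n
... | no  _ = s≤s z≤n

distK-refl : ∀ {n} (x : Fin n) → distK x x ≡ 0
distK-refl x with x ≟ᶠ x
... | yes _   = refl
... | no  x≢x = ⊥-elim (x≢x refl)

distK≡1⇒≢ : ∀ {n} {x y : Fin n} → distK x y ≡ 1 → x ≢ y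
distK≡1⇒≢ {x = x} {y} d≡1 with x ≟ᶠ y
distK≡1⇒≢ () | yes _
distK≡1⇒≢ _  | no x≢y = x≢y

+-tight : ∀ {m n p q} → p ≤ m → q ≤ n → m + n ≤ p + q → p ≡ m × q ≡ n
+-tight {m} {n} {p} {q} p≤m q≤n m+n≤p+q =
  ≤-antisym p≤m (+-cancelʳ-≤ n m p (≤-trans m+n≤p+q (+-monoʳ-≤ p q≤n))) ,
  ≤-antisym q≤n (+-cancelˡ-≤ m n q (≤-trans m+n≤p+q (+-monoˡ-≤ q p≤m)))

Distinct₃ : {A : Set} → A → A → A → Set
Distinct₃ x y z = x ≢ y × y ≢ z × x ≢ z

Fin2-flip : {x y z : Fin 2} → x ≢ y → y ≢ z → x ≡ z
Fin2-flip {x} {y} {z} = toWitness {a? = all? λ x → all? λ y → all? λ z →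
  ¬? (x ≟ᶠ y) →-dec ¬? (y ≟ᶠ z) →-dec x ≟ᶠ z} _ x y z

Fin3-period : {w x y z : Fin 3} → Distinct₃ w x y → Distinct₃ x y z → w ≡ z
Fin3-period {w} {x} {y} {z} = toWitness {a? = all? λ w → all? λ x → all? λ y → all? λ z →
  distinct₃? w x y →-dec distinct₃? x y z →-dec w ≟ᶠ z} _ w x y z
  where
  distinct₃? : (x y z : Fin 3) → Dec (Distinct₃ x y z)
  distinct₃? x y z = ¬? (x ≟ᶠ y) ×-dec ¬? (y ≟ᶠ z) ×-dec ¬? (x ≟ᶠ z)

G : Graph
G = K 2 □ K 3 □ K 3

Vertex : Set
Vertex = V G

_≟ᵛ_ : (u v : Vertex) → Dec (u ≡ v)
_≟ᵛ_ = ≡-dec _≟ᶠ_ (≡-dec _≟ᶠ_ _≟ᶠ_)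

anyVertex? : {P : Vertex → Set} → Decidable P → Dec (∃ P)
anyVertex? P? = map′ (λ (a , b , c , p) → (a , b , c) , p) (λ ((a , b , c) , p) → a , b , c , p)
  (any? λ a → any? λ b → any? λ c → P? (a , b , c))

allVertex? : {P : Vertex → Set} → Decidable P → Dec (∀ v → P v)
allVertex? P? = map′ (λ all (a , b , c) → all a b c) (λ all a b c → all (a , b , c))
  (all? λ a → all? λ b → all? λ c → P? (a , b , c))

enumeration : Fin 18 ↣ Vertex
enumeration = ↔⇒↣ (↔-trans *↔× (↔-refl ×-↔ *↔×))

dist : Vertex → Vertex → ℕ
dist (a , b , c) (a′ , b′ , c′) = distK a a′ + (distK b b′ + distK c c′)

Dist-G : ∀ u v → Dist G u v (dist u v)
Dist-G (a , b , c) (a′ , b′ , c′) = Dist-□ (Dist-K a a′) (Dist-□ (Dist-K b b′) (Dist-K c c′))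

dist≤3 : ∀ u v → dist u v ≤ 3
dist≤3 (a , b , c) (a′ , b′ , c′) = +-mono-≤ (distK≤1 a a′) (+-mono-≤ (distK≤1 b b′) (distK≤1 c c′))

diam-G : IsDiam G 3
diam-G = (λ u v → dist u v , dist≤3 u v , proj₁ (Dist-G u v)) ,
         (# 0 , # 0 , # 0) , (# 1 , # 1 , # 1) , Dist-G _ _

-- The shape of three vertices carrying consecutive labels.
Alternating : Vertex → Vertex → Vertex → Set
Alternating (a , b , c) (a′ , b′ , c′) (a″ , b″ , c″) =
  a ≢ a′ × a′ ≢ a″ × Distinct₃ b b′ b″ × Distinct₃ c c′ c″

dist≥3⇒apart : ∀ {a a′ b b′ c c′} → 3 ≤ dist (a , b , c) (a′ , b′ , c′) → a ≢ a′ × b ≢ b′ × c ≢ c′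
dist≥3⇒apart {a} {a′} {b} {b′} {c} {c′} 3≤d
  with da , dbc ← +-tight (distK≤1 a a′) (+-mono-≤ (distK≤1 b b′) (distK≤1 c c′)) 3≤d
  with db , dc ← +-tight (distK≤1 b b′) (distK≤1 c c′) (≤-reflexive (sym dbc))
  = distK≡1⇒≢ da , distK≡1⇒≢ db , distK≡1⇒≢ dc

dist≥2⇒apart : ∀ {a a′ b b′ c c′} → a ≡ a′ → 2 ≤ dist (a , b , c) (a′ , b′ , c′) → b ≢ b′ × c ≢ c′
dist≥2⇒apart {a} {_} {b} {b′} {c} {c′} refl 2≤d
  with db , dc ← +-tight (distK≤1 b b′) (distK≤1 c c′) (subst (λ t → 2 ≤ t + _) (distK-refl a) 2≤d)
  = distK≡1⇒≢ db , distK≡1⇒≢ dc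

alternating : ∀ {x y z} → 3 ≤ dist x y → 3 ≤ dist y z → 2 ≤ dist x z → Alternating x y z
alternating {x} {y} {z} xy yz xz
  with a≢a′ , b≢b′ , c≢c′ ← dist≥3⇒apart {a = proj₁ x} xy
  with a′≢a″ , b′≢b″ , c′≢c″ ← dist≥3⇒apart {a = proj₁ y} yz
  with b≢b″ , c≢c″ ← dist≥2⇒apart {a = proj₁ x} (Fin2-flip a≢a′ a′≢a″) xz
  = a≢a′ , a′≢a″ , (b≢b′ , b′≢b″ , b≢b″) , (c≢c′ , c′≢c″ , c≢c″)

alternating-period : ∀ {x₀ x₁ x₂ x₃ x₄ x₅ x₆} →
  Alternating x₀ x₁ x₂ → Alternating x₁ x₂ x₃ → Alternating x₂ x₃ x₄ →
  Alternating x₃ x₄ x₅ → Alternating x₄ x₅ x₆ → x₀ ≡ x₆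
alternating-period (a₀₁ , a₁₂ , b₀ , c₀) (_ , _ , b₁ , c₁) (a₂₃ , a₃₄ , _ , _)
                   (_ , _ , b₃ , c₃) (a₄₅ , a₅₆ , b₄ , c₄) =
  cong₂ _,_ (trans (Fin2-flip a₀₁ a₁₂) (trans (Fin2-flip a₂₃ a₃₄) (Fin2-flip a₄₅ a₅₆)))
            (cong₂ _,_ (trans (Fin3-period b₀ b₁) (Fin3-period b₃ b₄))
                       (trans (Fin3-period c₀ c₁) (Fin3-period c₃ c₄)))

module _ {A : Set} {n : ℕ} {F : A → Fin (suc n)} {p : Fin (suc n)} (p∉F : ∀ a → F a ≢ p) where

  punchOutImage : A → Fin n
  punchOutImage a = punchOut (p∉F a ∘ sym)

  punchOutImage-injective : Injective _≡_ _≡_ F → Injective _≡_ _≡_ punchOutImage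
  punchOutImage-injective F-injective {a} {b} = F-injective ∘ punchOut-injective (p∉F a ∘ sym) (p∉F b ∘ sym)

  punchOutImage-∉ : ∀ {q} (p≢q : p ≢ q) → (∀ a → F a ≢ q) → ∀ a → punchOutImage a ≢ punchOut p≢q
  punchOutImage-∉ p≢q q∉F a = q∉F a ∘ punchOut-injective (p∉F a ∘ sym) p≢q

injective⇒≤-missing₂ : ∀ {m n} {F : Fin m → Fin (2 + n)} {p q} → Injective _≡_ _≡_ F →
                       p ≢ q → (∀ i → F i ≢ p) → (∀ i → F i ≢ q) → m ≤ n
injective⇒≤-missing₂ F-injective p≢q p∉F q∉F =
  injective⇒≤ (punchOutImage-injective (punchOutImage-∉ p∉F p≢q q∉F)
                                      (punchOutImage-injective p∉F F-injective))

window : ∀ s → s ≤ 12 → Fin 7 → Fin 19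
window s s≤12 i = fromℕ< (+-mono-<-≤ (toℕ<n i) s≤12)

toℕ-window : ∀ s (s≤12 : s ≤ 12) i → toℕ (window s s≤12 i) ≡ toℕ i + s
toℕ-window s s≤12 i = toℕ-fromℕ< _

windows-disjoint : ∀ i j → window 0 z≤n i ≢ window 7 (m≤m+n 7 5) j
windows-disjoint i j eq = <⇒≱ (+-monoˡ-< 0 (toℕ<n i)) (begin
  7                               ≤⟨ m≤n+m 7 (toℕ j) ⟩
  toℕ j + 7                       ≡⟨ toℕ-window 7 (m≤m+n 7 5) j ⟨
  toℕ (window 7 (m≤m+n 7 5) j)    ≡⟨ cong toℕ eq ⟨
  toℕ (window 0 z≤n i)            ≡⟨ toℕ-window 0 z≤n i ⟩
  toℕ i + 0                       ∎)
  where open ≤-Reasoning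

-- ℓ v is the label of v minus one, an index into the 19 admissible values; label differences are unchanged.
module LowerBound (ℓ : Vertex → Fin 19)
                  (radio : ∀ u v → u ≢ v → 4 ≤ ∣ toℕ (ℓ u) - toℕ (ℓ v) ∣ + dist u v) where

  label : Vertex → ℕ
  label = toℕ ∘ ℓ

  ℓ-injective : Injective _≡_ _≡_ ℓ
  ℓ-injective {u} {v} ℓu≡ℓv = decidable-stable (u ≟ᵛ v) λ u≢v →
    <⇒≱ (subst (λ t → 4 ≤ t + dist u v) same-label (radio u v u≢v)) (dist≤3 u v)
    where
    same-label : ∣ label u - label v ∣ ≡ 0
    same-label = trans (cong (λ w → ∣ label u - toℕ w ∣) (sym ℓu≡ℓv)) (∣n-n∣≡0 (label u))

  labels-apart : ∀ {x y} k → label y ≡ suc k + label x → 3 ≤ k + dist x y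
  labels-apart {x} {y} k y≡ = s≤s⁻¹ (subst (λ t → 4 ≤ t + dist x y) gap (radio x y x≢y))
    where
    gap : ∣ label x - label y ∣ ≡ suc k
    gap = trans (cong (∣ label x -_∣) (trans y≡ (+-comm (suc k) (label x)))) (∣m-m+n∣≡n (label x) (suc k))
    x≢y : x ≢ y
    x≢y x≡y = m≢1+n+m (label x) (trans (cong label x≡y) y≡)

  consecutive : ∀ {x y z j} → label x ≡ j → label y ≡ suc j → label z ≡ suc (suc j) → Alternating x y z
  consecutive refl y≡ z≡ =
    alternating (labels-apart 0 y≡) (labels-apart 0 (trans z≡ (cong suc (sym y≡)))) (s≤s⁻¹ (labels-apart 1 z≡))

  Occupied : Fin 19 → Set
  Occupied p = ∃ λ v → ℓ v ≡ p

  no-full-window : ∀ s s≤12 → ¬ (∀ i → Occupied (window s s≤12 i))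
  no-full-window s s≤12 occupied = m≢1+n+m s (trans (sym (l (# 0))) (trans (cong label x₀≡x₆) (l (# 6))))
    where
    x : Fin 7 → Vertex
    x i = proj₁ (occupied i)
    l : ∀ i → label (x i) ≡ toℕ i + s
    l i = trans (cong toℕ (proj₂ (occupied i))) (toℕ-window s s≤12 i)
    x₀≡x₆ : x (# 0) ≡ x (# 6)
    x₀≡x₆ = alternating-period (consecutive (l (# 0)) (l (# 1)) (l (# 2))) (consecutive (l (# 1)) (l (# 2)) (l (# 3)))
                               (consecutive (l (# 2)) (l (# 3)) (l (# 4))) (consecutive (l (# 3)) (l (# 4)) (l (# 5)))
                               (consecutive (l (# 4)) (l (# 5)) (l (# 6)))

  window-gap : ∀ s s≤12 → ∃ λ i → ∀ v → ℓ v ≢ window s s≤12 i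
  window-gap s s≤12 = decidable-stable (any? λ i → all-≢? (window s s≤12 i)) λ no-gap →
    no-full-window s s≤12 λ i → decidable-stable (occupied? _) λ ¬occupied → no-gap (i , λ v e → ¬occupied (v , e))
    where
    occupied? : ∀ p → Dec (Occupied p)
    occupied? p = anyVertex? λ v → ℓ v ≟ᶠ p
    all-≢? : ∀ p → Dec (∀ v → ℓ v ≢ p)
    all-≢? p = allVertex? λ v → ¬? (ℓ v ≟ᶠ p)

  impossible : ⊥
  impossible = 1+n≰n (injective⇒≤-missing₂ {F = ℓ ∘ enum} (λ e → enum-injective (ℓ-injective e))
                        (windows-disjoint (proj₁ gap₁) (proj₁ gap₂)) (proj₂ gap₁ ∘ enum) (proj₂ gap₂ ∘ enum))
    where
    gap₁ : ∃ λ i → ∀ v → ℓ v ≢ window 0 z≤n i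
    gap₁ = window-gap 0 z≤n
    gap₂ : ∃ λ i → ∀ v → ℓ v ≢ window 7 (m≤m+n 7 5) i
    gap₂ = window-gap 7 (m≤m+n 7 5)
    enum : Fin 18 → Vertex
    enum = Injection.to enumeration
    enum-injective : Injective _≡_ _≡_ enum
    enum-injective = Injection.injective enumeration

-- It skips exactly the labels 7 and 14, one in each block of seven that the lower bound forces.
labeling : Vertex → ℕ
labeling (0F , 0F , 0F) = 1
labeling (0F , 0F , 1F) = 8
labeling (0F , 0F , 2F) = 15
labeling (0F , 1F , 0F) = 19
labeling (0F , 1F , 1F) = 5
labeling (0F , 1F , 2F) = 12
labeling (0F , 2F , 0F) = 10
labeling (0F , 2F , 1F) = 17
labeling (0F , 2F , 2F) = 3
labeling (1F , 0F , 0F) = 4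
labeling (1F , 0F , 1F) = 11
labeling (1F , 0F , 2F) = 18
labeling (1F , 1F , 0F) = 16
labeling (1F , 1F , 1F) = 2
labeling (1F , 1F , 2F) = 9
labeling (1F , 2F , 0F) = 13
labeling (1F , 2F , 1F) = 20
labeling (1F , 2F , 2F) = 6

upper-bound : ∃[ f ] (IsRadioLabeling G f × (∀ v → f v ≤ 20))
upper-bound = labeling , isRadioLabeling dist diam-G Dist-G positive far , bounded
  where
  positive : ∀ v → 1 ≤ labeling v
  positive = toWitness {a? = allVertex? λ v → 1 ≤? labeling v} _
  bounded : ∀ v → labeling v ≤ 20
  bounded = toWitness {a? = allVertex? λ v → labeling v ≤? 20} _
  far : ∀ u v → u ≢ v → 4 ≤ ∣ labeling u - labeling v ∣ + dist u v
  far = toWitness {a? = allVertex? λ u → allVertex? λ v →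
    ¬? (u ≟ᵛ v) →-dec 4 ≤? ∣ labeling u - labeling v ∣ + dist u v} _

positive≤⇒suc-toℕ : ∀ {m n} → 1 ≤ m → m ≤ n → ∃ λ (p : Fin n) → m ≡ suc (toℕ p)
positive≤⇒suc-toℕ {suc k} _ k<n = fromℕ< k<n , cong suc (sym (toℕ-fromℕ< k<n))

lower-bound : ∀ f → IsRadioLabeling G f → ∃[ v ] (20 ≤ f v)
lower-bound f (f≥1 , radio) with anyVertex? (λ v → 20 ≤? f v)
... | yes large = large
... | no ¬large = ⊥-elim (LowerBound.impossible (proj₁ ∘ slot) radio′)
  where
  slot : ∀ v → ∃ λ (p : Fin 19) → f v ≡ suc (toℕ p)
  slot v = positive≤⇒suc-toℕ (f≥1 v) (s≤s⁻¹ (≰⇒> λ 20≤fv → ¬large (v , 20≤fv)))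
  radio′ : ∀ u v → u ≢ v → 4 ≤ ∣ toℕ (proj₁ (slot u)) - toℕ (proj₁ (slot v)) ∣ + dist u v
  radio′ u v u≢v = subst (λ t → 4 ≤ t + dist u v) (cong₂ ∣_-_∣ (proj₂ (slot u)) (proj₂ (slot v)))
                         (radio 3 diam-G u v u≢v (dist u v) (Dist-G u v))

mainTheorem11 : RadioNumber (K 2 □ K 3 □ K 3) 20
mainTheorem11 = upper-bound , lower-bound
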